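{- Let $n\ge 2$, $k\ge 1$, $m=2n+k$. Let $\tau,\rho\in\mathrm{Aut}(SG_{n,k})$ be given by $\tau S=S+1$ and $\rho S=\{k-s: s\in S\}$, with arithmetic modulo $m$, and let $\bar\tau,\bar\rho\in\mathrm{Aut}(K_{k+2})$ be given by $\bar\tau x=x+1$, $\bar\rho x=k-x$, with arithmetic modulo $k+2$. Let $c\colon SG_{n,k}\to K_{k+2}$ be the canonical colouring. Then $c\circ\tau\sim\bar\tau\circ c$ and $c\circ\rho\sim\bar\rho\circ c$.
   Context: For $n\ge1$, $k\ge0$, $m=2n+k$: a subset $S\subseteq\{0,\dots,m-1\}$ is stable if $\{i,i+1\}\not\subseteq S$ for all $0\le i\le m-2$ and $\{0,m-1\}\not\subseteq S$. The stable Kneser graph $SG_{n,k}$ has as vertices the stable $n$-element subsets of $\{0,\dots,m-1\}$, two adjacent iff disjoint. $K_{k+2}$ is the complete graph on $\{0,\dots,k+1\}$. The canonical colouring is $c(S)=\min S$. For graphs $G,H$ and maps $f,g\colon V(G)\to V(H)$, $f\sim g$ means $(f(u),g(v))\in E(H)$ for all $(u,v)\in E(G)$ (adjacency in the graph $[G,H]$ of maps $V(G)\to V(H)$). -}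

module Defs where

open import Data.Nat using (ℕ; zero; suc; _+_; _*_; _∸_; _<_)
open import Data.Nat.DivMod using (_%_)
open import Data.Nat.DivMod using (m%n<n)
open import Relation.Binary.PropositionalEquality using (_≡_)
open import Data.Bool using (Bool; true; false)
open import Data.Fin using (Fin; toℕ; fromℕ<)
open import Data.Fin.Subset using (Subset; _∈_; _∩_; Empty; ∣_∣)
open import Data.Vec using (Vec; []; _∷_; lookup; tabulate)
open import Data.Product using (Σ; _×_)
open import Relation.Nullary using (¬_)

_∈ℕ_ : ∀ {m} → ℕ → Subset m → Set
_∈ℕ_ {m} i S = Σ (i < m) λ p → fromℕ< p ∈ S

Stable : ∀ {m} → Subset m → Set
Stable {m} S =
  (∀ i → suc i < m → ¬ (i ∈ℕ S × suc i ∈ℕ S)) × ¬ (0 ∈ℕ S × (m ∸ 1) ∈ℕ S)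

-- vertices of SG_{n,k}, as subsets of {0,…,2n+k-1}
IsVertex : (n k : ℕ) → Subset (2 * n + k) → Set
IsVertex n k S = Stable S × ∣ S ∣ ≡ n

-- adjacency in SG_{n,k}: disjointness
Disjoint : ∀ {m} → Subset m → Subset m → Set
Disjoint S T = Empty (S ∩ T)

-- canonical colouring c(S) = min S (as a natural number; equals m for the empty set,
-- which never occurs for vertices)
minS : ∀ {m} → Subset m → ℕ
minS [] = 0
minS (true ∷ _) = 0
minS (false ∷ v) = suc (minS v)

modF : ∀ {m} → ℕ → Fin (suc m)
modF {m} i = fromℕ< (m%n<n i (suc m))

-- τ S = S + 1 (mod m): j ∈ τ S iff j - 1 ∈ S
τ : ∀ {m} → Subset m → Subset m
τ {zero} S = S
τ {suc m} S = tabulate λ j → lookup S (modF (toℕ j + m))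

-- ρ S = { k - s : s ∈ S } (mod m): j ∈ ρ S iff k - j ∈ S
ρ : (k : ℕ) → ∀ {m} → Subset m → Subset m
ρ k {zero} S = S
ρ k {suc m} S = tabulate λ j → lookup S (modF (k + suc m ∸ toℕ j))

τ̄ : (k : ℕ) → ℕ → ℕ
τ̄ k x = (x + 1) % suc (suc k)

ρ̄ : (k : ℕ) → ℕ → ℕ
ρ̄ k x = (k + suc (suc k) ∸ x) % suc (suc k)

-- Write b = c(T) = min T. Counting along {b, …, m-1} with no two consecutive
-- elements shows 2n + b ≤ m + [m-1 ∈ T], so b ≤ k + 1, and b = k + 1 forces
-- m - 1 ∈ T. If b ≤ k, then τ̄ b = b + 1 and ρ̄ b = k - b lie below m, and
-- c(τS) = τ̄ b or c(ρS) = ρ̄ b gives b + 1 ∈ τS or k - b ∈ ρS, i.e. b ∈ S.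
-- If b = k + 1, then c(τS) = 0 puts m - 1 into S, and c(ρS) = k + 1 means
-- S ∩ {0, …, k} = ∅, so k + 1 = min S; either way S meets T.
module Submission where

open import Defs
open import Data.Nat using (ℕ; _≤_; _*_; _+_)
open import Data.Fin.Subset using (Subset)
open import Data.Product using (_×_)
open import Relation.Binary.PropositionalEquality using (_≢_)

open import Data.Bool using (Bool; true; false; if_then_else_)
open import Data.Empty using (⊥; ⊥-elim)
open import Data.Fin using (Fin; toℕ; fromℕ<)
open import Data.Fin.Properties using (toℕ-fromℕ<)
open import Data.Fin.Subset using (_∈_; ∣_∣)
open import Data.Fin.Subset.Properties using (x∈p∩q⁺)
open import Data.Nat using (zero; suc; pred; _∸_; _<_; _%_; z≤n; s≤s; s≤s⁻¹)
open import Data.Nat.DivMod using ([m+n]%n≡m%n; m<n⇒m%n≡m; m%n<n; n%n≡0)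
open import Data.Nat.Properties
open import Data.Product using (_,_; proj₁)
open import Data.Sum using (inj₁; inj₂)
open import Data.Vec using (Vec; []; _∷_; lookup; tabulate)
open import Data.Vec.Properties using (lookup⇒[]=)
open import Relation.Binary.PropositionalEquality
  using (_≡_; refl; sym; trans; cong; subst; module ≡-Reasoning)

lookupℕ : ∀ {m} → Vec Bool m → ℕ → Bool
lookupℕ []      _       = false
lookupℕ (x ∷ _) zero    = x
lookupℕ (_ ∷ v) (suc i) = lookupℕ v i

infix 4 _∋ℕ_
_∋ℕ_ : ∀ {m} → Vec Bool m → ℕ → Set
v ∋ℕ i = lookupℕ v i ≡ true

∋ℕ⇒< : ∀ {m} (v : Vec Bool m) {i} → v ∋ℕ i → i < m
∋ℕ⇒< (_ ∷ _) {zero}  _   = s≤s z≤n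
∋ℕ⇒< (_ ∷ v) {suc i} v∋i = s≤s (∋ℕ⇒< v v∋i)

lookup-fromℕ< : ∀ {m} (v : Vec Bool m) {i} (i<m : i < m) → lookup v (fromℕ< i<m) ≡ lookupℕ v i
lookup-fromℕ< (_ ∷ _) {zero}  _         = refl
lookup-fromℕ< (_ ∷ v) {suc i} (s≤s i<m) = lookup-fromℕ< v i<m

lookupℕ-tabulate : ∀ {m} (f : Fin m → Bool) {j} (j<m : j < m) → lookupℕ (tabulate f) j ≡ f (fromℕ< j<m)
lookupℕ-tabulate {suc m} f {zero}  _         = refl
lookupℕ-tabulate {suc m} f {suc j} (s≤s j<m) = lookupℕ-tabulate (λ x → f (Data.Fin.suc x)) j<m

∋ℕ⇒∈ : ∀ {m} (v : Subset m) {i} (i<m : i < m) → v ∋ℕ i → fromℕ< i<m ∈ v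
∋ℕ⇒∈ v i<m v∋i = lookup⇒[]= _ v (trans (lookup-fromℕ< v i<m) v∋i)

∋ℕ⇒∈ℕ : ∀ {m} (v : Subset m) {i} → v ∋ℕ i → i ∈ℕ v
∋ℕ⇒∈ℕ v v∋i = ∋ℕ⇒< v v∋i , ∋ℕ⇒∈ v (∋ℕ⇒< v v∋i) v∋i

minS-minimal : ∀ {m} (v : Vec Bool m) {i} → v ∋ℕ i → minS v ≤ i
minS-minimal (true  ∷ _) _           = z≤n
minS-minimal (false ∷ v) {suc i} v∋i = s≤s (minS-minimal v v∋i)

minS-∋ℕ : ∀ {m} (v : Vec Bool m) → minS v < m → v ∋ℕ minS v
minS-∋ℕ (true  ∷ _) _           = refl
minS-∋ℕ (false ∷ v) (s≤s min<m) = minS-∋ℕ v min<m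

minS≡⇒∋ℕ : ∀ {m} (v : Vec Bool m) {i} → minS v ≡ i → i < m → v ∋ℕ i
minS≡⇒∋ℕ v refl min<m = minS-∋ℕ v min<m

Disjoint⇒¬common : ∀ {m} {S T : Subset m} → Disjoint S T → ∀ {i} → S ∋ℕ i → T ∋ℕ i → ⊥
Disjoint⇒¬common {m} {S} {T} S∩T≡∅ {i} S∋i T∋i =
  S∩T≡∅ (_ , x∈p∩q⁺ (∋ℕ⇒∈ S i<m S∋i , ∋ℕ⇒∈ T i<m T∋i))
  where
  i<m : i < m
  i<m = ∋ℕ⇒< S S∋i

lookupℕ-τ : ∀ {M} (S : Vec Bool (suc M)) {j} → j < suc M →
            lookupℕ (τ S) j ≡ lookupℕ S ((j + M) % suc M)
lookupℕ-τ {M} S {j} j<m = begin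
  lookupℕ (τ S) j                                   ≡⟨ lookupℕ-tabulate (λ x → lookup S (modF (toℕ x + M))) j<m ⟩
  lookup S (modF (toℕ (fromℕ< j<m) + M))            ≡⟨ lookup-fromℕ< S (m%n<n (toℕ (fromℕ< j<m) + M) (suc M)) ⟩
  lookupℕ S ((toℕ (fromℕ< j<m) + M) % suc M)        ≡⟨ cong (λ x → lookupℕ S ((x + M) % suc M)) (toℕ-fromℕ< j<m) ⟩
  lookupℕ S ((j + M) % suc M)                       ∎
  where open ≡-Reasoning

lookupℕ-ρ : ∀ k {M} (S : Vec Bool (suc M)) {j} → j < suc M →
            lookupℕ (ρ k S) j ≡ lookupℕ S ((k + suc M ∸ j) % suc M)
lookupℕ-ρ k {M} S {j} j<m = begin
  lookupℕ (ρ k S) j                                 ≡⟨ lookupℕ-tabulate (λ x → lookup S (modF (k + suc M ∸ toℕ x))) j<m ⟩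
  lookup S (modF (k + suc M ∸ toℕ (fromℕ< j<m)))    ≡⟨ lookup-fromℕ< S (m%n<n (k + suc M ∸ toℕ (fromℕ< j<m)) (suc M)) ⟩
  lookupℕ S ((k + suc M ∸ toℕ (fromℕ< j<m)) % suc M) ≡⟨ cong (λ x → lookupℕ S ((k + suc M ∸ x) % suc M)) (toℕ-fromℕ< j<m) ⟩
  lookupℕ S ((k + suc M ∸ j) % suc M)               ∎
  where open ≡-Reasoning

lookupℕ-τ-suc : ∀ {M} (S : Vec Bool (suc M)) {j} → j < M → lookupℕ (τ S) (suc j) ≡ lookupℕ S j
lookupℕ-τ-suc {M} S {j} j<M = begin
  lookupℕ (τ S) (suc j)           ≡⟨ lookupℕ-τ S (s≤s j<M) ⟩
  lookupℕ S ((suc j + M) % suc M) ≡⟨ cong (λ x → lookupℕ S (x % suc M)) (sym (+-suc j M)) ⟩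
  lookupℕ S ((j + suc M) % suc M) ≡⟨ cong (lookupℕ S) ([m+n]%n≡m%n j (suc M)) ⟩
  lookupℕ S (j % suc M)           ≡⟨ cong (lookupℕ S) (m<n⇒m%n≡m (≤-trans j<M (n≤1+n M))) ⟩
  lookupℕ S j                     ∎
  where open ≡-Reasoning

lookupℕ-τ-zero : ∀ {M} (S : Vec Bool (suc M)) → lookupℕ (τ S) 0 ≡ lookupℕ S M
lookupℕ-τ-zero {M} S = trans (lookupℕ-τ S (s≤s z≤n)) (cong (lookupℕ S) (m<n⇒m%n≡m ≤-refl))

lookupℕ-ρ-∸ : ∀ k {M} (S : Vec Bool (suc M)) {i} → i ≤ k → k < suc M →
              lookupℕ (ρ k S) (k ∸ i) ≡ lookupℕ S i
lookupℕ-ρ-∸ k {M} S {i} i≤k k<m = begin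
  lookupℕ (ρ k S) (k ∸ i)                     ≡⟨ lookupℕ-ρ k S (≤-<-trans (m∸n≤m k i) k<m) ⟩
  lookupℕ S ((k + suc M ∸ (k ∸ i)) % suc M)   ≡⟨ cong (λ x → lookupℕ S (x % suc M)) (+-∸-comm (suc M) (m∸n≤m k i)) ⟩
  lookupℕ S ((k ∸ (k ∸ i) + suc M) % suc M)   ≡⟨ cong (λ x → lookupℕ S ((x + suc M) % suc M)) (m∸[m∸n]≡n i≤k) ⟩
  lookupℕ S ((i + suc M) % suc M)             ≡⟨ cong (lookupℕ S) ([m+n]%n≡m%n i (suc M)) ⟩
  lookupℕ S (i % suc M)                       ≡⟨ cong (lookupℕ S) (m<n⇒m%n≡m (≤-<-trans i≤k k<m)) ⟩
  lookupℕ S i                                 ∎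
  where open ≡-Reasoning

τ̄-≤ : ∀ {k b} → b ≤ k → τ̄ k b ≡ suc b
τ̄-≤ {k} {b} b≤k = trans (cong (_% suc (suc k)) (+-comm b 1)) (m<n⇒m%n≡m (s≤s (s≤s b≤k)))

τ̄-suc : ∀ k → τ̄ k (suc k) ≡ 0
τ̄-suc k = trans (cong (_% suc (suc k)) (+-comm (suc k) 1)) (n%n≡0 (suc (suc k)))

ρ̄-≤ : ∀ {k b} → b ≤ k → ρ̄ k b ≡ k ∸ b
ρ̄-≤ {k} {b} b≤k = begin
  (k + suc (suc k) ∸ b) % suc (suc k)   ≡⟨ cong (_% suc (suc k)) (+-∸-comm (suc (suc k)) b≤k) ⟩
  (k ∸ b + suc (suc k)) % suc (suc k)   ≡⟨ [m+n]%n≡m%n (k ∸ b) (suc (suc k)) ⟩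
  (k ∸ b) % suc (suc k)                 ≡⟨ m<n⇒m%n≡m (s≤s (≤-trans (m∸n≤m k b) (n≤1+n k))) ⟩
  k ∸ b                                 ∎
  where open ≡-Reasoning

ρ̄-suc : ∀ k → ρ̄ k (suc k) ≡ suc k
ρ̄-suc k = begin
  (k + suc (suc k) ∸ suc k) % suc (suc k)   ≡⟨ cong (λ x → (x ∸ suc k) % suc (suc k)) (+-suc k (suc k)) ⟩
  (suc k + suc k ∸ suc k) % suc (suc k)     ≡⟨ cong (_% suc (suc k)) (m+n∸n≡m (suc k) (suc k)) ⟩
  suc k % suc (suc k)                       ≡⟨ m<n⇒m%n≡m ≤-refl ⟩
  suc k                                     ∎
  where open ≡-Reasoning

NoConsecutive : ∀ {m} → Vec Bool m → Set
NoConsecutive v = ∀ i → v ∋ℕ i → v ∋ℕ suc i → ⊥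

Stable⇒NoConsecutive : ∀ {m} {S : Subset m} → Stable S → NoConsecutive S
Stable⇒NoConsecutive {S = S} stable i S∋i S∋1+i =
  proj₁ stable i (∋ℕ⇒< S S∋1+i) (∋ℕ⇒∈ℕ S S∋i , ∋ℕ⇒∈ℕ S S∋1+i)

NoConsecutive-tail : ∀ {m} x (v : Vec Bool m) → NoConsecutive (x ∷ v) → NoConsecutive v
NoConsecutive-tail _ _ nc i = nc (suc i)

lastBit : ∀ {m} → Vec Bool m → ℕ
lastBit {m} v = if lookupℕ v (pred m) then 1 else 0

lastBit≤1 : ∀ {m} (v : Vec Bool m) → lastBit v ≤ 1
lastBit≤1 {m} v with lookupℕ v (pred m)
... | true  = ≤-refl
... | false = z≤n

-- All elements of v lie in {minS v, …, m - 1}, and each one except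
-- possibly m - 1 is followed by a non-element.
2∣v∣+minS≤m+lastBit : ∀ {m} (v : Vec Bool m) → NoConsecutive v → 2 * ∣ v ∣ + minS v ≤ m + lastBit v
2∣v∣+minS≤m+lastBit []                _  = z≤n
2∣v∣+minS≤m+lastBit (false ∷ [])      _  = s≤s z≤n
2∣v∣+minS≤m+lastBit (true  ∷ [])      _  = s≤s (s≤s z≤n)
2∣v∣+minS≤m+lastBit (true ∷ true ∷ _) nc = ⊥-elim (nc 0 refl refl)
2∣v∣+minS≤m+lastBit (false ∷ y ∷ w) nc =
  ≤-trans (≤-reflexive (+-suc (2 * ∣ y ∷ w ∣) (minS (y ∷ w))))
          (s≤s (2∣v∣+minS≤m+lastBit (y ∷ w) (NoConsecutive-tail false (y ∷ w) nc)))
2∣v∣+minS≤m+lastBit {suc (suc m)} (true ∷ false ∷ w) nc =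
  step (2∣v∣+minS≤m+lastBit (false ∷ w) (NoConsecutive-tail true (false ∷ w) nc))
  where
  step : ∀ {c} → 2 * ∣ w ∣ + suc (minS w) ≤ suc m + c → 2 * suc ∣ w ∣ + 0 ≤ suc (suc m) + c
  step ih = ≤-trans (≤-reflexive (trans (+-identityʳ (2 * suc ∣ w ∣)) (*-suc 2 ∣ w ∣)))
    (s≤s (s≤s (≤-trans (m≤m+n (2 * ∣ w ∣) (minS w))
                       (s≤s⁻¹ (≤-trans (≤-reflexive (sym (+-suc (2 * ∣ w ∣) (minS w)))) ih)))))

minS≤k+lastBit : ∀ {n k} {V : Subset (2 * n + k)} → IsVertex n k V → minS V ≤ k + lastBit V
minS≤k+lastBit {n} {k} {V} (stable , ∣V∣≡n) = +-cancelˡ-≤ (2 * n) (minS V) (k + lastBit V) (begin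
  2 * n + minS V         ≡⟨ cong (λ x → 2 * x + minS V) (sym ∣V∣≡n) ⟩
  2 * ∣ V ∣ + minS V     ≤⟨ 2∣v∣+minS≤m+lastBit V (Stable⇒NoConsecutive stable) ⟩
  2 * n + k + lastBit V  ≡⟨ +-assoc (2 * n) k (lastBit V) ⟩
  2 * n + (k + lastBit V) ∎)
  where open ≤-Reasoning

minS≤1+k : ∀ {n k} {V : Subset (2 * n + k)} → IsVertex n k V → minS V ≤ suc k
minS≤1+k {k = k} {V} V-vertex =
  ≤-trans (minS≤k+lastBit V-vertex) (≤-trans (+-monoʳ-≤ k (lastBit≤1 V)) (≤-reflexive (+-comm k 1)))

minS≡1+k⇒∋last : ∀ {n k} {V : Subset (2 * n + k)} → IsVertex n k V →
                 minS V ≡ suc k → V ∋ℕ pred (2 * n + k)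
minS≡1+k⇒∋last {n} {k} {V} V-vertex minS≡1+k
  with lookupℕ V (pred (2 * n + k)) | minS≤k+lastBit V-vertex
... | true  | _         = refl
... | false | minS≤k+0 =
  ⊥-elim (1+n≰n (≤-trans (subst (_≤ k + 0) minS≡1+k minS≤k+0) (≤-reflexive (+-identityʳ k))))

module _ (n k : ℕ) {S T : Subset (2 * suc n + k)}
         (S-vertex : IsVertex (suc n) k S) (T-vertex : IsVertex (suc n) k T)
         (S∩T≡∅ : Disjoint S T) where

  private
    1+k<m : suc k < 2 * suc n + k
    1+k<m = +-monoˡ-≤ k (*-monoʳ-≤ 2 (s≤s (z≤n {n})))

    k<m : k < 2 * suc n + k
    k<m = ≤-trans (n≤1+n _) 1+k<m

    ∋minS : ∀ {V} → IsVertex (suc n) k V → V ∋ℕ minS V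
    ∋minS {V} V-vertex = minS-∋ℕ V (≤-<-trans (minS≤1+k V-vertex) 1+k<m)

    common : ∀ {i} → S ∋ℕ i → T ∋ℕ i → ⊥
    common = Disjoint⇒¬common S∩T≡∅

  minS-τ≢τ̄-minS : minS (τ S) ≢ τ̄ k (minS T)
  minS-τ≢τ̄-minS eq with m≤n⇒m<n∨m≡n (minS≤1+k T-vertex)
  ... | inj₁ (s≤s b≤k) = common S∋b (∋minS T-vertex)
    where
    1+b<m : suc (minS T) < 2 * suc n + k
    1+b<m = ≤-<-trans (s≤s b≤k) 1+k<m
    S∋b : S ∋ℕ minS T
    S∋b = trans (sym (lookupℕ-τ-suc S (s≤s⁻¹ 1+b<m))) (minS≡⇒∋ℕ (τ S) (trans eq (τ̄-≤ b≤k)) 1+b<m)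
  ... | inj₂ b≡1+k = common S∋last (minS≡1+k⇒∋last T-vertex b≡1+k)
    where
    τS∋0 : τ S ∋ℕ 0
    τS∋0 = minS≡⇒∋ℕ (τ S) (trans eq (trans (cong (τ̄ k) b≡1+k) (τ̄-suc k))) (s≤s z≤n)
    S∋last : S ∋ℕ pred (2 * suc n + k)
    S∋last = trans (sym (lookupℕ-τ-zero S)) τS∋0

  minS-ρ≢ρ̄-minS : minS (ρ k S) ≢ ρ̄ k (minS T)
  minS-ρ≢ρ̄-minS eq with m≤n⇒m<n∨m≡n (minS≤1+k T-vertex)
  ... | inj₁ (s≤s b≤k) = common S∋b (∋minS T-vertex)
    where
    ρS∋k∸b : ρ k S ∋ℕ k ∸ minS T
    ρS∋k∸b = minS≡⇒∋ℕ (ρ k S) (trans eq (ρ̄-≤ b≤k)) (≤-<-trans (m∸n≤m k (minS T)) k<m)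
    S∋b : S ∋ℕ minS T
    S∋b = trans (sym (lookupℕ-ρ-∸ k S b≤k k<m)) ρS∋k∸b
  ... | inj₂ b≡1+k = common (subst (S ∋ℕ_) a≡1+k (∋minS S-vertex)) (subst (T ∋ℕ_) b≡1+k (∋minS T-vertex))
    where
    minSρS≡1+k : minS (ρ k S) ≡ suc k
    minSρS≡1+k = trans eq (trans (cong (ρ̄ k) b≡1+k) (ρ̄-suc k))
    a≡1+k : minS S ≡ suc k
    a≡1+k with m≤n⇒m<n∨m≡n (minS≤1+k S-vertex)
    ... | inj₂ a≡1+k = a≡1+k
    ... | inj₁ (s≤s a≤k) = ⊥-elim (1+n≰n (begin
      suc k          ≡⟨ sym minSρS≡1+k ⟩
      minS (ρ k S)   ≤⟨ minS-minimal (ρ k S) (trans (lookupℕ-ρ-∸ k S a≤k k<m) (∋minS S-vertex)) ⟩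
      k ∸ minS S     ≤⟨ m∸n≤m k (minS S) ⟩
      k              ∎))
      where open ≤-Reasoning

lemma4p5 : (n k : ℕ) → 2 ≤ n → 1 ≤ k →
    (S T : Subset (2 * n + k)) → IsVertex n k S → IsVertex n k T → Disjoint S T →
    (minS (τ S) ≢ τ̄ k (minS T)) × (minS (ρ k S) ≢ ρ̄ k (minS T))
lemma4p5 zero    _ () _ _ _ _ _ _
lemma4p5 (suc n) k _ _ S T S-vertex T-vertex S∩T≡∅ =
  minS-τ≢τ̄-minS n k S-vertex T-vertex S∩T≡∅ , minS-ρ≢ρ̄-minS n k S-vertex T-vertex S∩T≡∅
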